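{- Let $E$ be a finite set, $w\colon E\to\mathbb{R}_{>0}$, $M\geq1$, and $f\colon 2^{E}\to\mathbb{R}_{\geq0}$ monotone, $M$-bounded and fractionally subadditive. Let $C,C'\in\mathbb{R}$ with $0<C\leq C'\leq w(E)$. Then $f^{*}(C')\leq\frac{C'}{C}\bigl(f(S^{*}_{C',C})+M\bigr)$.
   Context: $w(S):=\sum_{e\in S}w(e)$, and for $C>0$, $f^{*}(C):=\max\{f(S):S\subseteq E,\ w(S)\leq C\}$; for each $C>0$ a set $S^{*}_{C}\subseteq E$ with $w(S^{*}_{C})\leq C$ and $f(S^{*}_{C})=f^{*}(C)$ is fixed. For $X\subseteq E$, $(\mathrm{LP}_{X})$ is: minimize $\sum_{B\subseteq E}\alpha_{B}f(B)$ s.t. $\sum_{B\ni e}\alpha_{B}\geq1$ for all $e\in X$, $\alpha\geq0$; its dual is: maximize $\sum_{e\in X}\gamma_{e}$ s.t. $\sum_{e\in B}\gamma_{e}\leq f(B)$ for all $B\subseteq E$, $\gamma\geq0$. For each $X$ an optimal dual solution $\gamma^{*}(X)\in\mathbb{R}^{E}$ is fixed (by fractional subadditivity it satisfies $f(X)=\sum_{e\in X}\gamma^{*}_{e}(X)$). Write $S^{*}_{C'}=\{e_{1},\dots,e_{n}\}$ ordered so that $\gamma^{*}_{e_{j}}(S^{*}_{C'})/w(e_{j})\geq\gamma^{*}_{e_{j+1}}(S^{*}_{C'})/w(e_{j+1})$ for all $j<n$, and let $S^{*}_{C',C}:=\{e_{1},\dots,e_{j}\}$ where $j$ is the largest index in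 $\{0,\dots,n\}$ with $w(\{e_{1},\dots,e_{j}\})\leq C$ (the prefix of capacity $C$). The objective $f$ is monotone if $f(A)\geq f(B)$ for $A\supseteq B$; $M$-bounded if $f(\{e\})\in[1,M]$ for all $e$; fractionally subadditive if $f(A)\leq\sum_{i}\alpha_{i}f(B_{i})$ for all $A,B_{1},\dots,B_{k}\subseteq E$ and $\alpha_{i}\geq0$ with $\sum_{i:\,e\in B_{i}}\alpha_{i}\geq1$ for all $e\in A$. -}

module Defs where

open import Level using (Level; _⊔_) renaming (suc to lsuc)
open import Data.Nat using (ℕ; zero; suc; _<?_)
import Data.Nat as ℕ
open import Data.Fin using (Fin; toℕ; _≟_)
open import Data.Fin.Subset using (Subset; Side; inside; outside; _∈_; _⊆_; ⁅_⁆)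
open import Data.Fin.Properties using (any?)
open import Data.Vec using (lookup; tabulate)
open import Data.Product using (_×_; Σ; ∃)
open import Relation.Nullary using (¬_; Dec; yes; no)
open import Relation.Nullary.Decidable using (_×-dec_)
open import Relation.Binary using (Rel; IsTotalOrder)
open import Relation.Binary.PropositionalEquality using (_≡_)
open import Algebra.Bundles using (CommutativeRing)

-- An ordered field (ℝ is an instance).  The inverse is a total function,
-- only specified on non-zero elements.
record OrderedField (c ℓ₁ ℓ₂ : Level) : Set (lsuc (c ⊔ ℓ₁ ⊔ ℓ₂)) where
  field
    commutativeRing : CommutativeRing c ℓ₁
  open CommutativeRing commutativeRing public
  infix 4 _≤_
  infix 8 _⁻¹
  field
    _≤_          : Rel Carrier ℓ₂
    isTotalOrder : IsTotalOrder _≈_ _≤_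
    +-mono-≤     : ∀ {a b} c → a ≤ b → (a + c) ≤ (b + c)
    *-nonneg     : ∀ {a b} → 0# ≤ a → 0# ≤ b → 0# ≤ (a * b)
    0≉1          : ¬ (0# ≈ 1#)
    _⁻¹          : Carrier → Carrier
    ⁻¹-inverse   : ∀ x → ¬ (x ≈ 0#) → (x * x ⁻¹) ≈ 1#

  infix 4 _<_
  _<_ : Rel Carrier (ℓ₁ ⊔ ℓ₂)
  a < b = (a ≤ b) × ¬ (a ≈ b)

module _ {c ℓ₁ ℓ₂} (R : OrderedField c ℓ₁ ℓ₂) where
  open OrderedField R

  sumFin : (n : ℕ) → (Fin n → Carrier) → Carrier
  sumFin zero    g = 0#
  sumFin (suc n) g = g Fin.zero + sumFin n (λ i → g (Fin.suc i))

  sel : Side → Carrier → Carrier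
  sel inside  x = x
  sel outside _ = 0#

  sumOver : ∀ {n} → Subset n → (Fin n → Carrier) → Carrier
  sumOver {n} S g = sumFin n (λ i → sel (lookup S i) (g i))

  Monotone : ∀ {n} → (Subset n → Carrier) → Set _
  Monotone {n} f = ∀ (A B : Subset n) → B ⊆ A → f B ≤ f A

  MBounded : ∀ {n} → Carrier → (Subset n → Carrier) → Set _
  MBounded {n} M f = ∀ (e : Fin n) → (1# ≤ f ⁅ e ⁆) × (f ⁅ e ⁆ ≤ M)

  FracSubadditive : ∀ {n} → (Subset n → Carrier) → Set _
  FracSubadditive {n} f =
    ∀ (A : Subset n) (k : ℕ) (B : Fin k → Subset n) (α : Fin k → Carrier) →
    (∀ i → 0# ≤ α i) →
    (∀ e → e ∈ A → 1# ≤ sumFin k (λ i → sel (lookup (B i) e) (α i))) →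
    f A ≤ sumFin k (λ i → α i * f (B i))

  -- γ is feasible for the dual of (LP_X) (the constraints do not depend on X)
  DualFeasible : ∀ {n} → (Subset n → Carrier) → (Fin n → Carrier) → Set _
  DualFeasible {n} f γ = (∀ e → 0# ≤ γ e) × (∀ (B : Subset n) → sumOver B γ ≤ f B)

  OptimalDual : ∀ {n} → (Subset n → Carrier) → Subset n → (Fin n → Carrier) → Set _
  OptimalDual f X γ =
    DualFeasible f γ × (∀ γ' → DualFeasible f γ' → sumOver X γ' ≤ sumOver X γ)

  -- S attains f*(C) = max { f(S) : w(S) ≤ C }
  IsOptimal : ∀ {n} → (Subset n → Carrier) → (Fin n → Carrier) → Carrier → Subset n → Set _
  IsOptimal {n} f w C S =
    (sumOver S w ≤ C) × (∀ (T : Subset n) → sumOver T w ≤ C → f T ≤ f S)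

-- {e(k) : toℕ k < j}, i.e. the set {e_1,…,e_j} of the first j enumerated elements
prefixSet : ∀ {m n} → (Fin m → Fin n) → ℕ → Subset n
prefixSet {m} e j =
  tabulate (λ i → decSide (any? (λ k → (toℕ k <? j) ×-dec (e k ≟ i))))
  where
  decSide : ∀ {p} {P : Set p} → Dec P → Side
  decSide (yes _) = inside
  decSide (no _)  = outside

-- Write γ for the optimal dual solution of (LP_S′).  First, f(S′) ≤ γ(S′) is LP duality: by Farkas'
-- lemma, proved by Fourier–Motzkin elimination over any ordered field, a dual-feasible γ′ with
-- γ′(S′) ≥ f(S′) exists as soon as every non-negative integer combination of these constraints with
-- vanishing left-hand side has a non-negative right-hand side, and fractional subadditivity says
-- exactly that.  Then a fractional knapsack argument bounds γ(S′).  Let e₀ be the first element of S′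
-- not in the prefix P and d its density γ/w.  Elements of P′ = P ∪ {e₀} have density at least d and
-- the others at most d, so γ(S′) ≤ γ(P′) + d (C′ − C), while d C ≤ d w(P′) ≤ γ(P′) by maximality
-- of P; hence γ(S′) ≤ (C′/C) γ(P′) ≤ (C′/C) (f(P) + f({e₀})) ≤ (C′/C) (f(P) + M).

module Submission where

open import Defs
open import Level using (Level; 0ℓ; _⊔_) renaming (suc to lsuc)
open import Function using (_∘_)
open import Function.Definitions using (Injective)
open import Data.Unit using (tt) renaming (⊤ to Unit)
open import Data.Product using (Σ; _×_; _,_; proj₁; proj₂; ∃)
open import Data.Sum using (_⊎_; inj₁; inj₂)
open import Data.Maybe using (Maybe; just; nothing)
open import Data.Nat using (ℕ; zero; suc)
import Data.Nat as ℕ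
import Data.Nat.Properties as ℕ
open import Data.Integer using (ℤ; +_; -[1+_]; _⊖_)
import Data.Integer as ℤ
import Data.Integer.Properties as ℤ
open import Data.Integer.Tactic.RingSolver using (solve-∀)
open import Data.Fin as Fin using (Fin; zero; suc; toℕ)
import Data.Fin.Properties as Fin
open import Data.Fin.Properties using (any?)
open import Data.Fin.Subset using (Subset; Side; inside; outside; _∈_; _∉_; _⊆_; ⊤; ⁅_⁆)
open import Data.Fin.Subset.Properties using (x∈⁅x⁆)
open import Data.Vec as Vec using (lookup)
import Data.Vec.Properties as Vec
import Data.Vec.Functional as Vector
open import Data.List as List using (List; []; _∷_; _++_; concatMap; allFin)
open import Data.List.Membership.Propositional using () renaming (_∈_ to _∈ₗ_)
open import Data.List.Membership.Propositional.Properties using (∈-map⁺; ∈-allFin; ∈-++⁺ˡ; ∈-++⁺ʳ)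
open import Data.List.Relation.Unary.All as All using (All; []; _∷_)
import Data.List.Relation.Unary.All.Properties as All
open import Data.List.Relation.Unary.Any as Any using (here)
open import Data.List.Relation.Unary.Any.Properties using (lookup-index)
open import Relation.Nullary using (¬_; yes; no; contradiction)
open import Relation.Nullary.Decidable using (_×-dec_)
open import Relation.Binary.PropositionalEquality as ≡ using (_≡_)
open import Relation.Binary.Bundles using (Poset)
open import Relation.Binary.Structures using (IsTotalOrder)
import Relation.Binary.Reasoning.PartialOrder as PartialOrderReasoning
import Relation.Binary.Reasoning.Setoid as SetoidReasoning
import Algebra.Properties.CommutativeSemigroup as CommutativeSemigroupProperties
import Algebra.Properties.Ring as RingProperties
import Algebra.Properties.Semiring.Mult as SemiringMult
import Algebra.Properties.Semiring.Sum as SemiringSum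
open import Algebra.Solver.Ring.AlmostCommutativeRing
  using (AlmostCommutativeRing; fromCommutativeRing; _-Raw-AlmostCommutative⟶_)
import Algebra.Solver.Ring as RingSolver

module ℕSum = SemiringSum ℕ.+-*-semiring
module ℤSum = SemiringSum ℤ.+-*-semiring

allSubsets : ∀ n → List (Subset n)
allSubsets zero    = Vec.[] ∷ []
allSubsets (suc n) = List.map (inside Vec.∷_) (allSubsets n) ++ List.map (outside Vec.∷_) (allSubsets n)

∈-allSubsets : ∀ {n} (B : Subset n) → B ∈ₗ allSubsets n
∈-allSubsets Vec.[]                    = here ≡.refl
∈-allSubsets {suc n} (inside Vec.∷ B)  = ∈-++⁺ˡ (∈-map⁺ (inside Vec.∷_) (∈-allSubsets B))
∈-allSubsets {suc n} (outside Vec.∷ B) = ∈-++⁺ʳ _ (∈-map⁺ (outside Vec.∷_) (∈-allSubsets B))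

module _ {m n} (e : Fin m → Fin n) (j : ℕ) where

  private
    lookup-prefixSet : ∀ i {s} → lookup (prefixSet e j) i ≡ s →
      (s ≡ inside → ∃ λ k → toℕ k ℕ.< j × e k ≡ i) × ((∃ λ k → toℕ k ℕ.< j × e k ≡ i) → s ≡ inside)
    lookup-prefixSet i i∈?
      with any? (λ k → (toℕ k ℕ.<? j) ×-dec (e k Fin.≟ i)) | ≡.trans (≡.sym i∈?) (Vec.lookup∘tabulate _ i)
    ... | yes k<j×ek≡i | ≡.refl = (λ _ → k<j×ek≡i) , λ _ → ≡.refl
    ... | no ¬k<j×ek≡i | ≡.refl = (λ ()) , λ k<j×ek≡i → contradiction k<j×ek≡i ¬k<j×ek≡i

  ∈-prefixSet⁻ : ∀ {i} → i ∈ prefixSet e j → ∃ λ k → toℕ k ℕ.< j × e k ≡ i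
  ∈-prefixSet⁻ {i} i∈ = proj₁ (lookup-prefixSet i (Vec.[]=⇒lookup i∈)) ≡.refl

  ∈-prefixSet⁺ : ∀ {k} → toℕ k ℕ.< j → e k ∈ prefixSet e j
  ∈-prefixSet⁺ {k} k<j = Vec.lookup⇒[]= (e k) _ (proj₂ (lookup-prefixSet (e k) ≡.refl) (k , k<j , ≡.refl))

δ : ∀ {n} → Fin n → Fin n → ℕ
δ zero    zero    = 1
δ zero    (suc _) = 0
δ (suc _) zero    = 0
δ (suc i) (suc j) = δ i j

module _ {a b p} {A : Set a} {B : Set b} {P : B → Set p} (f : A → List B) where

  All-concatMap⁺ : ∀ {xs} → (∀ {x} → x ∈ₗ xs → All P (f x)) → All P (concatMap f xs)
  All-concatMap⁺ all-f = All.concat⁺ (All.map⁺ (All.tabulate all-f))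

  All-concatMap⁻ : ∀ {xs} → All P (concatMap f xs) → ∀ {x} → x ∈ₗ xs → All P (f x)
  All-concatMap⁻ all = All.lookup (All.map⁻ (All.concat⁻ all))

module _ {c ℓ₁ ℓ₂ : Level} (R : OrderedField c ℓ₁ ℓ₂) where
  open OrderedField R hiding (zero) renaming (+-mono-≤ to +-monoˡ-≤)
  open RingProperties ring using (-‿involutive; -‿distribˡ-*; -‿distribʳ-*; -0#≈0#; -‿+-comm)
  open CommutativeSemigroupProperties +-commutativeSemigroup using (interchange)
  open SemiringMult semiring using (×-homo-+; ×1-homo-*) renaming (_×_ to _·ℕ_)

  module ≈-Reasoning = SetoidReasoning setoid

  fromℕ : ℕ → Carrier
  fromℕ n = n ·ℕ 1#

  fromℤ : ℤ → Carrier
  fromℤ (+ n)    = fromℕ n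
  fromℤ -[1+ n ] = - fromℕ (suc n)

  fromℤ-⊖ : ∀ m n → fromℤ (m ⊖ n) ≈ fromℕ m - fromℕ n
  fromℤ-⊖ zero    zero    = sym (-‿inverseʳ 0#)
  fromℤ-⊖ zero    (suc n) = sym (+-identityˡ _)
  fromℤ-⊖ (suc m) zero    = sym (trans (+-congˡ -0#≈0#) (+-identityʳ _))
  fromℤ-⊖ (suc m) (suc n) = begin
      fromℤ (suc m ⊖ suc n)               ≡⟨ ≡.cong fromℤ (ℤ.[1+m]⊖[1+n]≡m⊖n m n) ⟩
      fromℤ (m ⊖ n)                       ≈⟨ fromℤ-⊖ m n ⟩
      fromℕ m - fromℕ n                   ≈⟨ [a+b]-[a+d]≈b-d 1# (fromℕ m) (fromℕ n) ⟨
      (1# + fromℕ m) - (1# + fromℕ n)     ∎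
    where
    open ≈-Reasoning
    [a+b]-[a+d]≈b-d : ∀ a b d → (a + b) - (a + d) ≈ b - d
    [a+b]-[a+d]≈b-d a b d = begin
      (a + b) - (a + d)       ≈⟨ +-congˡ (-‿+-comm a d) ⟨
      (a + b) + (- a + - d)   ≈⟨ interchange a b (- a) (- d) ⟩
      (a - a) + (b - d)       ≈⟨ +-congʳ (-‿inverseʳ a) ⟩
      0# + (b - d)            ≈⟨ +-identityˡ _ ⟩
      b - d                   ∎

  fromℤ-neg : ∀ i → fromℤ (ℤ.- i) ≈ - fromℤ i
  fromℤ-neg -[1+ n ]    = sym (-‿involutive _)
  fromℤ-neg (+ zero)    = sym -0#≈0#
  fromℤ-neg (+ (suc n)) = refl

  fromℤ-+ : ∀ i j → fromℤ (i ℤ.+ j) ≈ fromℤ i + fromℤ j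
  fromℤ-+ -[1+ m ] -[1+ n ] = begin
      - fromℕ (suc (suc (m ℕ.+ n)))          ≡⟨ ≡.cong (λ k → - fromℕ (suc k)) (ℕ.+-suc m n) ⟨
      - fromℕ (suc m ℕ.+ suc n)              ≈⟨ -‿cong (×-homo-+ 1# (suc m) (suc n)) ⟩
      - (fromℕ (suc m) + fromℕ (suc n))      ≈⟨ -‿+-comm _ _ ⟨
      - fromℕ (suc m) + - fromℕ (suc n)      ∎
    where
      open ≈-Reasoning
  fromℤ-+ -[1+ m ] (+ n)    = trans (fromℤ-⊖ n (suc m)) (+-comm _ _)
  fromℤ-+ (+ m)    -[1+ n ] = fromℤ-⊖ m (suc n)
  fromℤ-+ (+ m)    (+ n)    = ×-homo-+ 1# m n

  fromℤ-*ℕ : ∀ m j → fromℤ (+ m ℤ.* j) ≈ fromℕ m * fromℤ j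
  fromℤ-*ℕ m (+ n)    = trans (reflexive (≡.cong fromℤ (≡.sym (ℤ.pos-* m n)))) (×1-homo-* m n)
  fromℤ-*ℕ m -[1+ n ] = begin
      fromℤ (+ m ℤ.* -[1+ n ])                ≡⟨ ≡.cong fromℤ (ℤ.neg-distribʳ-* (+ m) (+ suc n)) ⟨
      fromℤ (ℤ.- (+ m ℤ.* + suc n))           ≈⟨ fromℤ-neg (+ m ℤ.* + suc n) ⟩
      - fromℤ (+ m ℤ.* + suc n)               ≈⟨ -‿cong (fromℤ-*ℕ m (+ suc n)) ⟩
      - (fromℕ m * fromℕ (suc n))             ≈⟨ -‿distribʳ-* _ _ ⟩
      fromℕ m * - fromℕ (suc n)               ∎
    where
      open ≈-Reasoning

  fromℤ-* : ∀ i j → fromℤ (i ℤ.* j) ≈ fromℤ i * fromℤ j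
  fromℤ-* (+ m)    j = fromℤ-*ℕ m j
  fromℤ-* -[1+ m ] j = begin
      fromℤ (-[1+ m ] ℤ.* j)                  ≡⟨ ≡.cong fromℤ (ℤ.neg-distribˡ-* (+ suc m) j) ⟨
      fromℤ (ℤ.- (+ suc m ℤ.* j))             ≈⟨ fromℤ-neg (+ suc m ℤ.* j) ⟩
      - fromℤ (+ suc m ℤ.* j)                 ≈⟨ -‿cong (fromℤ-*ℕ (suc m) j) ⟩
      - (fromℕ (suc m) * fromℤ j)             ≈⟨ -‿distribˡ-* _ _ ⟩
      - fromℕ (suc m) * fromℤ j               ∎
    where
      open ≈-Reasoning

  almostCommutativeRing : AlmostCommutativeRing c ℓ₁
  almostCommutativeRing = fromCommutativeRing commutativeRing

  fromℤ-homomorphism : ℤ.+-*-rawRing -Raw-AlmostCommutative⟶ almostCommutativeRing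
  fromℤ-homomorphism = record
    { ⟦_⟧    = fromℤ
    ; +-homo = fromℤ-+
    ; *-homo = fromℤ-*
    ; -‿homo = fromℤ-neg
    ; 0-homo = refl
    ; 1-homo = +-identityʳ 1#
    }

  fromℤ-≟ : ∀ i j → Maybe (fromℤ i ≈ fromℤ j)
  fromℤ-≟ i j with i ℤ.≟ j
  ... | yes i≡j = just (reflexive (≡.cong fromℤ i≡j))
  ... | no _    = nothing

  module Solver = RingSolver ℤ.+-*-rawRing almostCommutativeRing fromℤ-homomorphism fromℤ-≟
  open Solver using (solve; _:+_; _:*_; _:-_; :-_; _:=_; con)

  open IsTotalOrder isTotalOrder using (total; antisym; isPartialOrder)
    renaming (refl to ≤-refl; trans to ≤-trans; reflexive to ≤-reflexive;
              ≤-respˡ-≈ to ≤-respˡ; ≤-respʳ-≈ to ≤-respʳ)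

  poset : Poset c ℓ₁ ℓ₂
  poset = record { isPartialOrder = isPartialOrder }

  module ≤-Reasoning = PartialOrderReasoning poset

  +-monoʳ-≤ : ∀ {a b} x → a ≤ b → x + a ≤ x + b
  +-monoʳ-≤ {a} {b} x a≤b = ≤-respʳ (+-comm b x) (≤-respˡ (+-comm a x) (+-monoˡ-≤ x a≤b))

  +-mono-≤ : ∀ {a b x y} → a ≤ b → x ≤ y → a + x ≤ b + y
  +-mono-≤ {b = b} {x} a≤b x≤y = ≤-trans (+-monoˡ-≤ x a≤b) (+-monoʳ-≤ b x≤y)

  x≤y⇒0≤y-x : ∀ {x y} → x ≤ y → 0# ≤ y - x
  x≤y⇒0≤y-x {x} x≤y = ≤-respˡ (-‿inverseʳ x) (+-monoˡ-≤ (- x) x≤y)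

  0≤y-x⇒x≤y : ∀ {x y} → 0# ≤ y - x → x ≤ y
  0≤y-x⇒x≤y {x} {y} 0≤y-x =
    ≤-respˡ (+-identityˡ x) (≤-respʳ (solve 2 (λ x y → (y :- x) :+ x := y) refl x y)
      (+-monoˡ-≤ x 0≤y-x))

  -‿antimono-≤ : ∀ {x y} → x ≤ y → - y ≤ - x
  -‿antimono-≤ {x} {y} x≤y = 0≤y-x⇒x≤y (≤-respʳ (solve 2 (λ x y → y :- x := (:- x) :- (:- y)) refl x y)
    (x≤y⇒0≤y-x x≤y))

  *-monoˡ-≤-nonNeg : ∀ {x a b} → 0# ≤ x → a ≤ b → x * a ≤ x * b
  *-monoˡ-≤-nonNeg {x} {a} {b} 0≤x a≤b = 0≤y-x⇒x≤y
    (≤-respʳ (solve 3 (λ x a b → x :* (b :- a) := x :* b :- x :* a) refl x a b)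
      (*-nonneg 0≤x (x≤y⇒0≤y-x a≤b)))

  *-monoʳ-≤-nonNeg : ∀ {x a b} → 0# ≤ x → a ≤ b → a * x ≤ b * x
  *-monoʳ-≤-nonNeg {x} {a} {b} 0≤x a≤b = ≤-respʳ (*-comm x b) (≤-respˡ (*-comm x a) (*-monoˡ-≤-nonNeg 0≤x a≤b))

  -- If 1 ≤ 0 then 0 ≤ -1, hence 0 ≤ (-1)(-1) = 1.
  0≤1 : 0# ≤ 1#
  0≤1 with total 0# 1#
  ... | inj₁ 0≤1 = 0≤1
  ... | inj₂ 1≤0 = ≤-respʳ (trans (solve 1 (λ o → (:- o) :* (:- o) := o :* o) refl 1#) (*-identityʳ 1#))
                     (*-nonneg 0≤-1 0≤-1)
    where
    0≤-1 : 0# ≤ - 1#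
    0≤-1 = ≤-respˡ -0#≈0# (-‿antimono-≤ 1≤0)

  1≤x⇒0≤x : ∀ {x} → 1# ≤ x → 0# ≤ x
  1≤x⇒0≤x = ≤-trans 0≤1

  x≤rx : ∀ {r x} → 1# ≤ r → 0# ≤ x → x ≤ r * x
  x≤rx {r} {x} 1≤r 0≤x = 0≤y-x⇒x≤y
    (≤-respʳ (trans (solve 3 (λ r o x → (r :- o) :* x := r :* x :- o :* x) refl r 1# x)
                    (+-congˡ (-‿cong (*-identityˡ x))))
      (*-nonneg (x≤y⇒0≤y-x 1≤r) 0≤x))

  0<x⇒x≉0 : ∀ {x} → 0# < x → ¬ (x ≈ 0#)
  0<x⇒x≉0 (_ , 0≉x) x≈0 = 0≉x (sym x≈0)

  fromℕ-nonNeg : ∀ n → 0# ≤ fromℕ n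
  fromℕ-nonNeg zero    = ≤-refl
  fromℕ-nonNeg (suc n) = ≤-respˡ (+-identityʳ 0#) (+-mono-≤ 0≤1 (fromℕ-nonNeg n))

  fromℕ-suc-pos : ∀ n → 0# < fromℕ (suc n)
  fromℕ-suc-pos n = fromℕ-nonNeg (suc n) , λ 0≈1+n → 0≉1 (antisym 0≤1 (≤-respʳ (sym 0≈1+n)
    (≤-respˡ (+-identityʳ 1#) (+-monoʳ-≤ 1# (fromℕ-nonNeg n)))))

  ⁻¹-nonNeg : ∀ {x} → 0# < x → 0# ≤ x ⁻¹
  ⁻¹-nonNeg {x} 0<x with total 0# (x ⁻¹)
  ... | inj₁ 0≤x⁻¹ = 0≤x⁻¹
  ... | inj₂ x⁻¹≤0 =
    contradiction (antisym 0≤1 (≤-respʳ -0#≈0# (≤-respˡ -x*-x⁻¹≈1 (-‿antimono-≤ 0≤x*-x⁻¹)))) 0≉1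
    where
    0≤x*-x⁻¹ : 0# ≤ x * - (x ⁻¹)
    0≤x*-x⁻¹ = *-nonneg (proj₁ 0<x) (≤-respˡ -0#≈0# (-‿antimono-≤ x⁻¹≤0))
    -x*-x⁻¹≈1 : - (x * - (x ⁻¹)) ≈ 1#
    -x*-x⁻¹≈1 = trans (-‿cong (sym (-‿distribʳ-* x (x ⁻¹))))
                  (trans (-‿involutive _) (⁻¹-inverse x (0<x⇒x≉0 0<x)))

  ⁻¹-inverseˡ : ∀ {x} → 0# < x → x ⁻¹ * x ≈ 1#
  ⁻¹-inverseˡ {x} 0<x = trans (*-comm _ _) (⁻¹-inverse x (0<x⇒x≉0 0<x))

  *-⁻¹-cancel : ∀ {z} x → 0# < z → z * (x * z ⁻¹) ≈ x
  *-⁻¹-cancel {z} x 0<z = begin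
    z * (x * z ⁻¹)    ≈⟨ solve 3 (λ z x z⁻¹ → z :* (x :* z⁻¹) := x :* (z :* z⁻¹)) refl z x (z ⁻¹) ⟩
    x * (z * z ⁻¹)    ≈⟨ *-congˡ (⁻¹-inverse z (0<x⇒x≉0 0<z)) ⟩
    x * 1#            ≈⟨ *-identityʳ x ⟩
    x                 ∎
    where
      open ≈-Reasoning

  y≤x⇒1≤x*y⁻¹ : ∀ {x y} → 0# < y → y ≤ x → 1# ≤ x * y ⁻¹
  y≤x⇒1≤x*y⁻¹ {y = y} 0<y y≤x = ≤-respˡ (⁻¹-inverse y (0<x⇒x≉0 0<y)) (*-monoʳ-≤-nonNeg (⁻¹-nonNeg 0<y) y≤x)

  x≤y*z⁻¹⇒z*x≤y : ∀ {x y z} → 0# < z → x ≤ y * z ⁻¹ → z * x ≤ y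
  x≤y*z⁻¹⇒z*x≤y {y = y} 0<z x≤y/z = ≤-respʳ (*-⁻¹-cancel y 0<z) (*-monoˡ-≤-nonNeg (proj₁ 0<z) x≤y/z)

  x*z⁻¹≤y⇒x≤z*y : ∀ {x y z} → 0# < z → x * z ⁻¹ ≤ y → x ≤ z * y
  x*z⁻¹≤y⇒x≤z*y {x} 0<z x/z≤y = ≤-respˡ (*-⁻¹-cancel x 0<z) (*-monoˡ-≤-nonNeg (proj₁ 0<z) x/z≤y)

  -- Eliminating a variable between an upper and a lower bound on it.
  combination-≤⇒ratio-≤ : ∀ {α β a b x y} → 0# < α → 0# < β →
    α * a + β * b ≤ α * x + β * y → (b - y) * α ⁻¹ ≤ (x - a) * β ⁻¹
  combination-≤⇒ratio-≤ {α} {β} {a} {b} {x} {y} 0<α 0<β αa+βb≤αx+βy = begin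
    (b - y) * α ⁻¹
      ≈⟨ trans (*-congˡ (*-comm _ _)) (cancel β α (b - y) 0<β) ⟨
    (β * (b - y)) * (α ⁻¹ * β ⁻¹)
      ≤⟨ *-monoʳ-≤-nonNeg (*-nonneg (⁻¹-nonNeg 0<α) (⁻¹-nonNeg 0<β)) β[b-y]≤α[x-a] ⟩
    (α * (x - a)) * (α ⁻¹ * β ⁻¹)
      ≈⟨ cancel α β (x - a) 0<α ⟩
    (x - a) * β ⁻¹
      ∎
    where
    open ≤-Reasoning
    β[b-y]≤α[x-a] : β * (b - y) ≤ α * (x - a)
    β[b-y]≤α[x-a] = 0≤y-x⇒x≤y (≤-respʳ
      (solve 6 (λ α β a b x y → (α :* x :+ β :* y) :- (α :* a :+ β :* b) := α :* (x :- a) :- β :* (b :- y))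
        refl α β a b x y)
      (x≤y⇒0≤y-x αa+βb≤αx+βy))
    cancel : ∀ u v t → 0# < u → (u * t) * (u ⁻¹ * v ⁻¹) ≈ t * v ⁻¹
    cancel u v t 0<u = trans
      (solve 4 (λ u v t w → (u :* t) :* (w :* v) := (t :* v) :* (u :* w)) refl u (v ⁻¹) t (u ⁻¹))
      (trans (*-congˡ (⁻¹-inverse u (0<x⇒x≉0 0<u))) (*-identityʳ _))

  extrapolate-≤ : ∀ {d C C′ G} → 0# ≤ d → 0# < C → C ≤ C′ → d * C ≤ G →
    G + d * (C′ - C) ≤ (C′ * C ⁻¹) * G
  extrapolate-≤ {d} {C} {C′} {G} 0≤d 0<C C≤C′ dC≤G = begin
    G + d * (C′ - C)              ≈⟨ +-congˡ d[C′-C]≈[r-1]dC ⟩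
    G + (r - 1#) * (d * C)        ≤⟨ +-monoʳ-≤ G (*-monoˡ-≤-nonNeg (x≤y⇒0≤y-x 1≤r) dC≤G) ⟩
    G + (r - 1#) * G              ≈⟨ trans (solve 3 (λ g r o → g :+ (r :- o) :* g := r :* g :+ (g :- o :* g)) refl G r 1#)
                                       (trans (+-congˡ (trans (+-congˡ (-‿cong (*-identityˡ G))) (-‿inverseʳ G)))
                                         (+-identityʳ _)) ⟩
    r * G                         ∎
    where
    open ≤-Reasoning
    r : Carrier
    r = C′ * C ⁻¹
    rC≈C′ : r * C ≈ C′
    rC≈C′ = trans (*-assoc _ _ _) (trans (*-congˡ (⁻¹-inverseˡ 0<C)) (*-identityʳ C′))
    1≤r : 1# ≤ r
    1≤r = y≤x⇒1≤x*y⁻¹ 0<C C≤C′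
    d[C′-C]≈[r-1]dC : d * (C′ - C) ≈ (r - 1#) * (d * C)
    d[C′-C]≈[r-1]dC = sym (trans
      (solve 4 (λ r o d c → (r :- o) :* (d :* c) := d :* (r :* c :- o :* c)) refl r 1# d C)
      (*-congˡ (+-cong rC≈C′ (-‿cong (*-identityˡ C)))))

  x≤z-y⇒x+y≤z : ∀ {x y z} → x ≤ z - y → x + y ≤ z
  x≤z-y⇒x+y≤z {x} {y} {z} x≤z-y = ≤-respʳ (solve 2 (λ y z → z :- y :+ y := z) refl y z) (+-monoˡ-≤ y x≤z-y)

  y-z≤x⇒-x+y≤z : ∀ {x y z} → y - z ≤ x → - x + y ≤ z
  y-z≤x⇒-x+y≤z {x} {y} {z} y-z≤x = ≤-respˡ (solve 3 (λ x y z → y :- z :+ (z :- x) := (:- x) :+ y) refl x y z)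
    (≤-respʳ (solve 2 (λ x z → x :+ (z :- x) := z) refl x z) (+-monoˡ-≤ (z - x) y-z≤x))

  separate : (ds us : List Carrier) → All (λ d → All (d ≤_) us) ds →
    ∃ λ y → All (_≤ y) ds × All (y ≤_) us
  separate []       []       _ = 0# , [] , []
  separate []       (u ∷ us) _ with separate [] us []
  ... | y , [] , y≤us with total y u
  ...   | inj₁ y≤u = y , [] , y≤u ∷ y≤us
  ...   | inj₂ u≤y = u , [] , ≤-refl ∷ All.map (≤-trans u≤y) y≤us
  separate (d ∷ ds) us (d≤us ∷ ds≤us) with separate ds us ds≤us
  ... | y , ds≤y , y≤us with total d y
  ...   | inj₁ d≤y = y , d≤y ∷ ds≤y , y≤us
  ...   | inj₂ y≤d = d , ≤-refl ∷ All.map (λ d'≤y → ≤-trans d'≤y y≤d) ds≤y , d≤us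

  open SemiringSum semiring
    using (sum; sum-cong-≋; ∑-distrib-+; *-distribˡ-sum; *-distribʳ-sum; sum-replicate-zero)

  sumFin≡sum : ∀ n (g : Fin n → Carrier) → sumFin R n g ≡ sum g
  sumFin≡sum zero    g = ≡.refl
  sumFin≡sum (suc n) g = ≡.cong (_+_ (g zero)) (sumFin≡sum n (g ∘ suc))

  sum-cong : ∀ {n} {g h : Fin n → Carrier} → (∀ i → g i ≈ h i) → sum g ≈ sum h
  sum-cong = sum-cong-≋

  sum-zero : ∀ {n} {g : Fin n → Carrier} → (∀ i → g i ≈ 0#) → sum g ≈ 0#
  sum-zero {n} g≈0 = trans (sum-cong g≈0) (sum-replicate-zero n)

  sum-neg : ∀ {n} (g : Fin n → Carrier) → sum (λ i → - g i) ≈ - sum g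
  sum-neg {zero}  g = sym -0#≈0#
  sum-neg {suc n} g = trans (+-congˡ (sum-neg (g ∘ suc))) (-‿+-comm _ _)

  sum-mono-≤ : ∀ {n} {g h : Fin n → Carrier} → (∀ i → g i ≤ h i) → sum g ≤ sum h
  sum-mono-≤ {zero}  g≤h = ≤-refl
  sum-mono-≤ {suc n} g≤h = +-mono-≤ (g≤h zero) (sum-mono-≤ (g≤h ∘ suc))

  sum-nonNeg : ∀ {n} {g : Fin n → Carrier} → (∀ i → 0# ≤ g i) → 0# ≤ sum g
  sum-nonNeg {n} 0≤g = ≤-respˡ (sum-replicate-zero n) (sum-mono-≤ 0≤g)

  fromℤ-sum : ∀ {n} (g : Fin n → ℤ) → fromℤ (ℤSum.sum g) ≈ sum (fromℤ ∘ g)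
  fromℤ-sum {zero}  g = refl
  fromℤ-sum {suc n} g = trans (fromℤ-+ (g zero) _) (+-congˡ (fromℤ-sum (g ∘ suc)))

  fromℕ-sum : ∀ {n} (g : Fin n → ℕ) → fromℕ (ℕSum.sum g) ≈ sum (fromℕ ∘ g)
  fromℕ-sum {zero}  g = refl
  fromℕ-sum {suc n} g = trans (×-homo-+ 1# (g zero) _) (+-congˡ (fromℕ-sum (g ∘ suc)))

  sum-δ : ∀ {n} (j : Fin n) (g : Fin n → Carrier) → sum (λ i → fromℕ (δ j i) * g i) ≈ g j
  sum-δ {suc n} zero    g = trans
    (+-cong (trans (*-congʳ (+-identityʳ 1#)) (*-identityˡ _)) (sum-zero {g = λ i → 0# * g (suc i)} (λ i → zeroˡ _)))
    (+-identityʳ _)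
  sum-δ {suc n} (suc j) g = trans (+-cong (zeroˡ _) (sum-δ j (g ∘ suc))) (+-identityˡ _)

  sel-*ˡ : ∀ s x y → sel R s (x * y) ≈ x * sel R s y
  sel-*ˡ inside  x y = refl
  sel-*ˡ outside x y = sym (zeroʳ x)

  sel-*ʳ : ∀ s x y → sel R s (x * y) ≈ sel R s x * y
  sel-*ʳ inside  x y = refl
  sel-*ʳ outside x y = sym (zeroˡ y)

  sel-nonNeg : ∀ s {x} → 0# ≤ x → 0# ≤ sel R s x
  sel-nonNeg inside  0≤x = 0≤x
  sel-nonNeg outside _   = ≤-refl

  restrict : ∀ {n} → Subset n → (Fin n → Carrier) → Fin n → Carrier
  restrict S g i = sel R (lookup S i) (g i)

  sumOver≡sum : ∀ {n} (S : Subset n) g → sumOver R S g ≡ sum (restrict S g)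
  sumOver≡sum {n} S g = sumFin≡sum n (restrict S g)

  sumOver-mono-≤ : ∀ {n} (S : Subset n) {g h : Fin n → Carrier} → (∀ {i} → i ∈ S → g i ≤ h i) →
    sumOver R S g ≤ sumOver R S h
  sumOver-mono-≤ S {g} {h} g≤h rewrite sumOver≡sum S g | sumOver≡sum S h = sum-mono-≤ pointwise
    where
    pointwise : ∀ i → restrict S g i ≤ restrict S h i
    pointwise i with lookup S i in S[i]
    ... | inside  = g≤h (Vec.lookup⇒[]= i S S[i])
    ... | outside = ≤-refl

  sumOver-*ˡ : ∀ {n} (S : Subset n) x g → sumOver R S (λ i → x * g i) ≈ x * sumOver R S g
  sumOver-*ˡ S x g rewrite sumOver≡sum S (λ i → x * g i) | sumOver≡sum S g =
    trans (sum-cong (λ i → sel-*ˡ (lookup S i) x (g i))) (sym (*-distribˡ-sum x (restrict S g)))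

  sumOver-≤-∪ : ∀ {n} {A B C : Subset n} {g : Fin n → Carrier} → (∀ i → 0# ≤ g i) →
    (∀ {i} → i ∈ A → i ∈ B ⊎ i ∈ C) → sumOver R A g ≤ sumOver R B g + sumOver R C g
  sumOver-≤-∪ {A = A} {B} {C} {g} 0≤g A⊆B∪C rewrite sumOver≡sum A g | sumOver≡sum B g | sumOver≡sum C g =
    ≤-respʳ (∑-distrib-+ (restrict B g) (restrict C g)) (sum-mono-≤ pointwise)
    where
    pointwise : ∀ i → restrict A g i ≤ restrict B g i + restrict C g i
    pointwise i with lookup A i in A[i]
    ... | outside =
      ≤-respˡ (+-identityʳ 0#) (+-mono-≤ (sel-nonNeg (lookup B i) (0≤g i)) (sel-nonNeg (lookup C i) (0≤g i)))
    ... | inside with A⊆B∪C (Vec.lookup⇒[]= i A A[i])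
    ...   | inj₁ i∈B rewrite Vec.[]=⇒lookup i∈B =
              ≤-respˡ (+-identityʳ (g i)) (+-monoʳ-≤ (g i) (sel-nonNeg (lookup C i) (0≤g i)))
    ...   | inj₂ i∈C rewrite Vec.[]=⇒lookup i∈C =
              ≤-respˡ (+-identityˡ (g i)) (+-monoˡ-≤ (g i) (sel-nonNeg (lookup B i) (0≤g i)))

  -- Farkas' lemma by Fourier–Motzkin elimination

  module Farkas {K : ℕ} (b : Fin K → Carrier) where

    Multipliers : Set
    Multipliers = Fin K → ℕ

    infix 8 _·_
    _·_ : Multipliers → (Fin K → Carrier) → Carrier
    l · g = sum (λ r → fromℕ (l r) * g r)

    combine : ℕ → Multipliers → ℕ → Multipliers → Multipliers
    combine c l d m r = c ℕ.* l r ℕ.+ d ℕ.* m r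

    column : ∀ {n} → (Fin K → Fin n → ℤ) → Multipliers → Fin n → ℤ
    column A l i = ℤSum.sum (λ r → + l r ℤ.* A r i)

    row : ∀ {n} → (Fin K → Fin n → ℤ) → Fin K → (Fin n → Carrier) → Carrier
    row A r x = sum (λ i → fromℤ (A r i) * x i)

    dropColumn : ∀ {n} → (Fin K → Fin (suc n) → ℤ) → Fin K → Fin n → ℤ
    dropColumn A r i = A r (suc i)

    Satisfies : ∀ {n} → (Fin K → Fin n → ℤ) → (Fin n → Carrier) → Multipliers → Set ℓ₂
    Satisfies A x l = l · (λ r → row A r x) ≤ l · b

    ·-+ : ∀ l g h → l · (λ r → g r + h r) ≈ l · g + l · h
    ·-+ l g h = trans (sum-cong {K} (λ r → distribˡ _ _ _))
      (∑-distrib-+ (λ r → fromℕ (l r) * g r) (λ r → fromℕ (l r) * h r))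

    ·-*ʳ : ∀ l g y → l · (λ r → g r * y) ≈ (l · g) * y
    ·-*ʳ l g y = trans (sum-cong {K} (λ r → sym (*-assoc _ _ _))) (sym (*-distribʳ-sum y (λ r → fromℕ (l r) * g r)))

    ·-neg : ∀ l g → l · (λ r → - g r) ≈ - (l · g)
    ·-neg l g = trans (sum-cong {K} (λ r → sym (-‿distribʳ-* _ _))) (sum-neg (λ r → fromℕ (l r) * g r))

    ·-zero : ∀ l → l · (λ _ → 0#) ≈ 0#
    ·-zero l = sum-zero (λ r → zeroʳ (fromℕ (l r)))

    ·-combine : ∀ c l d m g → combine c l d m · g ≈ fromℕ c * (l · g) + fromℕ d * (m · g)
    ·-combine c l d m g = begin
      combine c l d m · g
        ≈⟨ sum-cong expand ⟩
      sum (λ r → fromℕ c * lg r + fromℕ d * mg r)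
        ≈⟨ ∑-distrib-+ (λ r → fromℕ c * lg r) (λ r → fromℕ d * mg r) ⟩
      sum (λ r → fromℕ c * lg r) + sum (λ r → fromℕ d * mg r)
        ≈⟨ +-cong (*-distribˡ-sum (fromℕ c) lg) (*-distribˡ-sum (fromℕ d) mg) ⟨
      fromℕ c * (l · g) + fromℕ d * (m · g)
        ∎
      where
      open ≈-Reasoning
      lg mg : Fin K → Carrier
      lg r = fromℕ (l r) * g r
      mg r = fromℕ (m r) * g r
      expand : ∀ r → fromℕ (combine c l d m r) * g r ≈ fromℕ c * lg r + fromℕ d * mg r
      expand r = trans
        (*-congʳ (trans (×-homo-+ 1# (c ℕ.* l r) _) (+-cong (×1-homo-* c (l r)) (×1-homo-* d (m r)))))
        (solve 5 (λ c l d m g → (c :* l :+ d :* m) :* g := c :* (l :* g) :+ d :* (m :* g))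
          refl (fromℕ c) (fromℕ (l r)) (fromℕ d) (fromℕ (m r)) (g r))

    column-combine : ∀ {n} A c l d m (i : Fin n) →
      column A (combine c l d m) i ≡ + c ℤ.* column A l i ℤ.+ + d ℤ.* column A m i
    column-combine A c l d m i = begin
      ℤSum.sum (λ r → + (c ℕ.* l r ℕ.+ d ℕ.* m r) ℤ.* A r i)
        ≡⟨ ℤSum.sum-cong-≋ expand ⟩
      ℤSum.sum (λ r → + c ℤ.* lA r ℤ.+ + d ℤ.* mA r)
        ≡⟨ ℤSum.∑-distrib-+ (λ r → + c ℤ.* lA r) (λ r → + d ℤ.* mA r) ⟩
      ℤSum.sum (λ r → + c ℤ.* lA r) ℤ.+ ℤSum.sum (λ r → + d ℤ.* mA r)
        ≡⟨ ≡.cong₂ ℤ._+_ (ℤSum.*-distribˡ-sum (+ c) lA) (ℤSum.*-distribˡ-sum (+ d) mA) ⟨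
      + c ℤ.* column A l i ℤ.+ + d ℤ.* column A m i
        ∎
      where
      open ≡.≡-Reasoning
      lA mA : Fin K → ℤ
      lA r = + l r ℤ.* A r i
      mA r = + m r ℤ.* A r i
      linear : ∀ c l d m a → (c ℤ.* l ℤ.+ d ℤ.* m) ℤ.* a ≡ c ℤ.* (l ℤ.* a) ℤ.+ d ℤ.* (m ℤ.* a)
      linear = solve-∀
      expand : ∀ r → + (c ℕ.* l r ℕ.+ d ℕ.* m r) ℤ.* A r i ≡ + c ℤ.* lA r ℤ.+ + d ℤ.* mA r
      expand r = ≡.trans
        (≡.cong (ℤ._* A r i)
          (≡.trans (ℤ.pos-+ (c ℕ.* l r) _) (≡.cong₂ ℤ._+_ (ℤ.pos-* c (l r)) (ℤ.pos-* d (m r)))))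
        (linear (+ c) (+ l r) (+ d) (+ m r) (A r i))

    ·-column : ∀ {n} A l (i : Fin n) → l · (λ r → fromℤ (A r i)) ≈ fromℤ (column A l i)
    ·-column A l i = sym (trans (fromℤ-sum (λ r → + l r ℤ.* A r i)) (sum-cong (λ r → fromℤ-*ℕ (l r) (A r i))))

    ·-row-∷ : ∀ {n} A l y (x : Fin n → Carrier) →
      l · (λ r → row A r (y Vector.∷ x)) ≈ fromℤ (column A l zero) * y + l · (λ r → row (dropColumn A) r x)
    ·-row-∷ A l y x = trans (·-+ l _ _) (+-congʳ (trans (·-*ʳ l _ y) (*-congʳ (·-column A l zero))))

    Closed : (Multipliers → Set) → Set
    Closed G = ∀ c d {l m} → G l → G m → G (combine c l d m)

    Consistent : ∀ {n} → (Fin K → Fin n → ℤ) → (Multipliers → Set) → Set ℓ₂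
    Consistent A G = ∀ l → G l → (∀ i → column A l i ≡ + 0) → 0# ≤ l · b

    -- The rows met during the elimination are non-negative integer combinations of the rows of the
    -- original system; G singles out the admissible ones (those annihilating the eliminated columns).
    Solvable : ∀ {n} → (Fin K → Fin n → ℤ) → Set (lsuc 0ℓ ⊔ c ⊔ ℓ₂)
    Solvable A = ∀ G → Closed G → Consistent A G →
      (L : List (Σ Multipliers G)) → ∃ λ x → All (Satisfies A x ∘ proj₁) L

    -- Rows with positive (negative) first coefficient bound the first variable y from above (below).
    -- The rows with zero first coefficient, together with the combinations of an upper and a lower
    -- row that cancel y, are solved recursively; some y then lies between all the bounds.
    module EliminateFirstColumn {n} (A : Fin K → Fin (suc n) → ℤ) (solvable : Solvable (dropColumn A))
      (G : Multipliers → Set) (closed : Closed G) (consistent : Consistent A G)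
      (L : List (Σ Multipliers G)) where

      G′ : Multipliers → Set
      G′ l = G l × column A l zero ≡ + 0

      closed′ : Closed G′
      closed′ c d {l} {m} (gl , l₀≡0) (gm , m₀≡0) = closed c d gl gm , (begin
        column A (combine c l d m) zero
          ≡⟨ column-combine A c l d m zero ⟩
        + c ℤ.* column A l zero ℤ.+ + d ℤ.* column A m zero
          ≡⟨ ≡.cong₂ (λ u v → + c ℤ.* u ℤ.+ + d ℤ.* v) l₀≡0 m₀≡0 ⟩
        + c ℤ.* + 0 ℤ.+ + d ℤ.* + 0
          ≡⟨ ≡.cong₂ ℤ._+_ (ℤ.*-zeroʳ (+ c)) (ℤ.*-zeroʳ (+ d)) ⟩
        + 0
          ∎)
        where
          open ≡.≡-Reasoning

      consistent′ : Consistent (dropColumn A) G′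
      consistent′ l (g , l₀≡0) columns≡0 = consistent l g λ { zero → l₀≡0 ; (suc i) → columns≡0 i }

      data Role (l : Multipliers) : Set where
        free  : column A l zero ≡ + 0 → Role l
        upper : ∀ k → column A l zero ≡ + suc k → Role l
        lower : ∀ k → column A l zero ≡ -[1+ k ] → Role l

      role : ∀ l → Role l
      role l with column A l zero in l₀≡
      ... | + zero   = free l₀≡
      ... | + suc k  = upper k l₀≡
      ... | -[1+ k ] = lower k l₀≡

      kept : ∀ {l} → G l → Role l → List (Σ Multipliers G′)
      kept g (free l₀≡0) = (_ , g , l₀≡0) ∷ []
      kept _ _           = []

      eliminated : ∀ {p q} → G p → G q → Role p → Role q → List (Σ Multipliers G′)
      eliminated {p} {q} gp gq (upper j p₀≡) (lower k q₀≡) =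
        (combine (suc k) p (suc j) q , closed (suc k) (suc j) gp gq , cancels) ∷ []
        where
        opposite : ∀ a b → a ℤ.* b ℤ.+ b ℤ.* ℤ.- a ≡ + 0
        opposite = solve-∀
        cancels : column A (combine (suc k) p (suc j) q) zero ≡ + 0
        cancels = ≡.trans (column-combine A (suc k) p (suc j) q zero) (≡.trans
          (≡.cong₂ (λ u v → + suc k ℤ.* u ℤ.+ + suc j ℤ.* v) p₀≡ q₀≡) (opposite (+ suc k) (+ suc j)))
      eliminated _ _ _ _ = []

      eliminatedWith : Σ Multipliers G → Σ Multipliers G → List (Σ Multipliers G′)
      eliminatedWith (p , gp) (q , gq) = eliminated gp gq (role p) (role q)

      derived : Σ Multipliers G → List (Σ Multipliers G′)
      derived (p , gp) = kept gp (role p) ++ concatMap (eliminatedWith (p , gp)) L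

      Satisfied′ : (Fin n → Carrier) → Σ Multipliers G′ → Set ℓ₂
      Satisfied′ x′ = Satisfies (dropColumn A) x′ ∘ proj₁

      reduced : ∃ λ x′ → All (Satisfied′ x′) (concatMap derived L)
      reduced = solvable G′ closed′ consistent′ (concatMap derived L)

      x′ : Fin n → Carrier
      x′ = proj₁ reduced

      kept-satisfied : ∀ {l g} → (l , g) ∈ₗ L → All (Satisfied′ x′) (kept g (role l))
      kept-satisfied {l} {g} l∈L = All.++⁻ˡ (kept g (role l)) (All-concatMap⁻ derived (proj₂ reduced) l∈L)

      eliminated-satisfied : ∀ {p gp q gq} → (p , gp) ∈ₗ L → (q , gq) ∈ₗ L →
        All (Satisfied′ x′) (eliminated gp gq (role p) (role q))
      eliminated-satisfied {p} {gp} p∈L =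
        All-concatMap⁻ (eliminatedWith (p , gp))
          (All.++⁻ʳ (kept gp (role p)) (All-concatMap⁻ derived (proj₂ reduced) p∈L))

      rest : Multipliers → Carrier
      rest l = l · (λ r → row (dropColumn A) r x′)

      upperBound : ∀ {l} → Role l → List Carrier
      upperBound {l} (upper k _) = (l · b - rest l) * fromℕ (suc k) ⁻¹ ∷ []
      upperBound _               = []

      lowerBound : ∀ {l} → Role l → List Carrier
      lowerBound {l} (lower k _) = (rest l - l · b) * fromℕ (suc k) ⁻¹ ∷ []
      lowerBound _               = []

      upperBoundOf lowerBoundOf : Σ Multipliers G → List Carrier
      upperBoundOf (l , _) = upperBound (role l)
      lowerBoundOf (l , _) = lowerBound (role l)

      uppers lowers : List Carrier
      uppers = concatMap upperBoundOf L
      lowers = concatMap lowerBoundOf L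

      lower≤upper : ∀ {p q} (gp : G p) (gq : G q) (ρp : Role p) (ρq : Role q) →
        All (Satisfied′ x′) (eliminated gp gq ρp ρq) → All (λ d → All (d ≤_) (upperBound ρp)) (lowerBound ρq)
      lower≤upper {p} {q} _ _ (upper j _) (lower k _) (combination ∷ []) =
        (combination-≤⇒ratio-≤ (fromℕ-suc-pos k) (fromℕ-suc-pos j)
          (≤-respˡ (·-combine (suc k) p (suc j) q _) (≤-respʳ (·-combine (suc k) p (suc j) q b) combination)) ∷ [])
        ∷ []
      lower≤upper _ _ (free _)    (lower _ _) _ = [] ∷ []
      lower≤upper _ _ (lower _ _) (lower _ _) _ = [] ∷ []
      lower≤upper _ _ _           (free _)    _ = []
      lower≤upper _ _ _           (upper _ _) _ = []

      lowers≤uppers : All (λ d → All (d ≤_) uppers) lowers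
      lowers≤uppers = All-concatMap⁺ lowerBoundOf λ {(q , gq)} q∈L → All.tabulate λ d∈ →
        All-concatMap⁺ upperBoundOf λ {(p , gp)} p∈L →
          All.lookup (lower≤upper gp gq (role p) (role q) (eliminated-satisfied p∈L q∈L)) d∈

      separated : ∃ λ y → All (_≤ y) lowers × All (y ≤_) uppers
      separated = separate lowers uppers lowers≤uppers

      y : Carrier
      y = proj₁ separated

      satisfied-by-role : ∀ {l} (g : G l) (ρ : Role l) → All (Satisfied′ x′) (kept g ρ) →
        All (_≤ y) (lowerBound ρ) → All (y ≤_) (upperBound ρ) → Satisfies A (y Vector.∷ x′) l
      satisfied-by-role {l} _ (free l₀≡0) (rest≤ ∷ []) _ _ = begin
        l · (λ r → row A r (y Vector.∷ x′))    ≈⟨ ·-row-∷ A l y x′ ⟩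
        fromℤ (column A l zero) * y + rest l   ≡⟨ ≡.cong (λ z → fromℤ z * y + rest l) l₀≡0 ⟩
        0# * y + rest l                        ≈⟨ trans (+-congʳ (zeroˡ y)) (+-identityˡ _) ⟩
        rest l                                 ≤⟨ rest≤ ⟩
        l · b                                  ∎
        where
          open ≤-Reasoning
      satisfied-by-role {l} _ (upper k l₀≡) _ _ (y≤u ∷ []) = begin
        l · (λ r → row A r (y Vector.∷ x′))    ≈⟨ ·-row-∷ A l y x′ ⟩
        fromℤ (column A l zero) * y + rest l   ≡⟨ ≡.cong (λ z → fromℤ z * y + rest l) l₀≡ ⟩
        fromℕ (suc k) * y + rest l             ≤⟨ x≤z-y⇒x+y≤z (x≤y*z⁻¹⇒z*x≤y (fromℕ-suc-pos k) y≤u) ⟩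
        l · b                                  ∎
        where
          open ≤-Reasoning
      satisfied-by-role {l} _ (lower k l₀≡) _ (d≤y ∷ []) _ = begin
        l · (λ r → row A r (y Vector.∷ x′))    ≈⟨ ·-row-∷ A l y x′ ⟩
        fromℤ (column A l zero) * y + rest l   ≡⟨ ≡.cong (λ z → fromℤ z * y + rest l) l₀≡ ⟩
        - fromℕ (suc k) * y + rest l           ≈⟨ +-congʳ (-‿distribˡ-* _ _) ⟨
        - (fromℕ (suc k) * y) + rest l         ≤⟨ y-z≤x⇒-x+y≤z (x*z⁻¹≤y⇒x≤z*y (fromℕ-suc-pos k) d≤y) ⟩
        l · b                                  ∎
        where
          open ≤-Reasoning

      solution : ∃ λ x → All (Satisfies A x ∘ proj₁) L
      solution = y Vector.∷ x′ , All.tabulate λ {(l , g)} l∈L →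
        satisfied-by-role g (role l) (kept-satisfied l∈L)
          (All-concatMap⁻ lowerBoundOf (proj₁ (proj₂ separated)) l∈L)
          (All-concatMap⁻ upperBoundOf (proj₂ (proj₂ separated)) l∈L)

    solvable : ∀ {n} (A : Fin K → Fin n → ℤ) → Solvable A
    solvable {zero}  A G _ consistent L =
      (λ ()) , All.tabulate λ {(l , g)} _ → ≤-respˡ (sym (·-zero l)) (consistent l g (λ ()))
    solvable {suc n} A G closed consistent L =
      EliminateFirstColumn.solution A (solvable (dropColumn A)) G closed consistent L

    farkas : ∀ {n} (A : Fin K → Fin n → ℤ) → (∀ l → (∀ i → column A l i ≡ + 0) → 0# ≤ l · b) →
      ∃ λ x → ∀ r → row A r x ≤ b r
    farkas A consistent = x , λ r → ≤-respˡ (sum-δ r (λ r′ → row A r′ x))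
      (≤-respʳ (sum-δ r b) (All.lookup satisfied (∈-map⁺ unitRow (∈-allFin r))))
      where
      unitRow : Fin K → Σ Multipliers (λ _ → Unit)
      unitRow r = δ r , tt
      solved : ∃ λ x → All (Satisfies A x ∘ proj₁) (List.map unitRow (allFin K))
      solved = solvable A (λ _ → Unit) (λ _ _ _ _ → tt) (λ l _ → consistent l) (List.map unitRow (allFin K))
      x : Fin _ → Carrier
      x = proj₁ solved
      satisfied : All (Satisfies A x ∘ proj₁) (List.map unitRow (allFin K))
      satisfied = proj₂ solved

  -- Fractionally subadditive functions are supported by dual solutions

  -- The dual constraints of (LP_X) together with γ(X) ≥ f(X), as a system of linear inequalities.
  module SupportingDual {n} (f : Subset n → Carrier) (X : Subset n) where

    data Constraint : Set where
      capacity : Subset n → Constraint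
      nonNeg   : Fin n → Constraint
      target   : Constraint

    indicator : Side → ℤ
    indicator inside  = + 1
    indicator outside = + 0

    coefficient : Constraint → Fin n → ℤ
    coefficient (capacity B) i = indicator (lookup B i)
    coefficient (nonNeg e)   i = ℤ.- (+ δ e i)
    coefficient target       i = ℤ.- indicator (lookup X i)

    bound : Constraint → Carrier
    bound (capacity B) = f B
    bound (nonNeg _)   = 0#
    bound target       = - f X

    constraints : List Constraint
    constraints = List.map capacity (allSubsets n) ++ List.map nonNeg (allFin n) ++ target ∷ []

    capacity∈ : ∀ B → capacity B ∈ₗ constraints
    capacity∈ B = ∈-++⁺ˡ (∈-map⁺ capacity (∈-allSubsets B))

    nonNeg∈ : ∀ e → nonNeg e ∈ₗ constraints
    nonNeg∈ e = ∈-++⁺ʳ (List.map capacity (allSubsets n)) (∈-++⁺ˡ (∈-map⁺ nonNeg (∈-allFin e)))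

    target∈ : target ∈ₗ constraints
    target∈ = ∈-++⁺ʳ (List.map capacity (allSubsets n)) (∈-++⁺ʳ (List.map nonNeg (allFin n)) (here ≡.refl))

    K : ℕ
    K = List.length constraints

    constraintAt : Fin K → Constraint
    constraintAt = List.lookup constraints

    open Farkas (bound ∘ constraintAt)

    coefficients : Fin K → Fin n → ℤ
    coefficients r = coefficient (constraintAt r)

    value : Constraint → (Fin n → Carrier) → Carrier
    value c x = sum (λ i → fromℤ (coefficient c i) * x i)

    indicator-* : ∀ s x → fromℤ (indicator s) * x ≈ sel R s x
    indicator-* inside  x = trans (*-congʳ (+-identityʳ 1#)) (*-identityˡ x)
    indicator-* outside x = zeroˡ x

    value-capacity : ∀ B x → value (capacity B) x ≈ sumOver R B x
    value-capacity B x = trans (sum-cong (λ i → indicator-* (lookup B i) (x i))) (reflexive (≡.sym (sumOver≡sum B x)))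

    value-nonNeg : ∀ e x → value (nonNeg e) x ≈ - x e
    value-nonNeg e x = trans (sum-cong (λ i → trans (*-congʳ (fromℤ-neg (+ δ e i))) (sym (-‿distribˡ-* _ _))))
      (trans (sum-neg (λ i → fromℕ (δ e i) * x i)) (-‿cong (sum-δ e x)))

    value-target : ∀ x → value target x ≈ - sumOver R X x
    value-target x = trans (sum-cong (λ i → trans (*-congʳ (fromℤ-neg (indicator (lookup X i))))
        (trans (sym (-‿distribˡ-* _ _)) (-‿cong (indicator-* (lookup X i) (x i))))))
      (trans (sum-neg (restrict X x)) (-‿cong (reflexive (≡.sym (sumOver≡sum X x)))))

    feasible⇒dualFeasible : ∀ x → (∀ r → row coefficients r x ≤ bound (constraintAt r)) →
      DualFeasible R f x × (f X ≤ sumOver R X x)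
    feasible⇒dualFeasible x feasible =
      ((λ e → ≤-respʳ (-‿involutive (x e)) (≤-respˡ -0#≈0# (-‿antimono-≤
        (≤-respˡ (value-nonNeg e x) (satisfied (nonNeg∈ e)))))) ,
      (λ B → ≤-respˡ (value-capacity B x) (satisfied (capacity∈ B)))) ,
      ≤-respˡ (-‿involutive (f X)) (≤-respʳ (-‿involutive _) (-‿antimono-≤
        (≤-respˡ (value-target x) (satisfied target∈))))
      where
      satisfied : ∀ {c} → c ∈ₗ constraints → value c x ≤ bound c
      satisfied c∈ = ≡.subst (λ c → value c x ≤ bound c) (≡.sym (lookup-index c∈)) (feasible (Any.index c∈))

    coverWeight targetWeight : Constraint → ℕ
    coverWeight (capacity _) = 1
    coverWeight _            = 0
    targetWeight target = 1
    targetWeight _      = 0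

    coveringSet : Constraint → Subset n
    coveringSet (capacity B) = B
    coveringSet _            = X

    bound-split : ∀ c → bound c ≈ fromℕ (coverWeight c) * f (coveringSet c) - fromℕ (targetWeight c) * f X
    bound-split (capacity B) = solve 2 (λ F G → F := con (+ 1) :* F :- con (+ 0) :* G) refl (f B) (f X)
    bound-split (nonNeg _)   = solve 1 (λ G → con (+ 0) := con (+ 0) :* G :- con (+ 0) :* G) refl (f X)
    bound-split target       = solve 1 (λ G → :- G := con (+ 0) :* G :- con (+ 1) :* G) refl (f X)

    covers : ∀ c e → lookup X e ≡ inside →
      fromℤ (coefficient c e) + fromℕ (targetWeight c) ≤ sel R (lookup (coveringSet c) e) (fromℕ (coverWeight c))
    covers (capacity B) e _ with lookup B e
    ... | inside  = ≤-reflexive (+-identityʳ _)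
    ... | outside = ≤-reflexive (+-identityʳ 0#)
    covers (nonNeg e′) e e∈X rewrite e∈X = ≤-respˡ (sym (trans (+-congʳ (fromℤ-neg (+ δ e′ e))) (+-identityʳ _)))
      (≤-respʳ -0#≈0# (-‿antimono-≤ (fromℕ-nonNeg (δ e′ e))))
    covers target e e∈X rewrite e∈X = ≤-reflexive (-‿inverseˡ _)

    module Certificate (0≤f : ∀ S → 0# ≤ f S) (fsa : FracSubadditive R f)
                       (l : Multipliers) (balanced : ∀ i → column coefficients l i ≡ + 0) where

      w t : Fin K → ℕ
      w = coverWeight ∘ constraintAt
      t = targetWeight ∘ constraintAt

      B : Fin K → Subset n
      B = coveringSet ∘ constraintAt

      T : ℕ
      T = ℕSum.sum (λ r → l r ℕ.* t r)

      P : Carrier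
      P = l · (λ r → fromℕ (w r) * f (B r))

      fromℕ-T : fromℕ T ≈ l · (fromℕ ∘ t)
      fromℕ-T = trans (fromℕ-sum (λ r → l r ℕ.* t r)) (sum-cong (λ r → ×1-homo-* (l r) (t r)))

      0≤P : 0# ≤ P
      0≤P = sum-nonNeg (λ r → *-nonneg (fromℕ-nonNeg (l r)) (*-nonneg (fromℕ-nonNeg (w r)) (0≤f (B r))))

      l·b≈P-Tf : l · (bound ∘ constraintAt) ≈ P - fromℕ T * f X
      l·b≈P-Tf = begin
        l · (bound ∘ constraintAt)
          ≈⟨ sum-cong (λ r → *-congˡ (bound-split (constraintAt r))) ⟩
        l · (λ r → fromℕ (w r) * f (B r) - fromℕ (t r) * f X)
          ≈⟨ trans (·-+ l _ _) (+-congˡ (·-neg l _)) ⟩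
        P - l · (λ r → fromℕ (t r) * f X)
          ≈⟨ +-congˡ (-‿cong (trans (·-*ʳ l _ (f X)) (*-congʳ (sym fromℕ-T)))) ⟩
        P - fromℕ T * f X
          ∎
        where
          open ≈-Reasoning

      coverage : ∀ e → e ∈ X → fromℕ T ≤ sum (λ r → sel R (lookup (B r) e) (fromℕ (l r) * fromℕ (w r)))
      coverage e e∈X = begin
        fromℕ T
          ≈⟨ trans (+-cong column≈0 (sym fromℕ-T)) (+-identityˡ _) ⟨
        l · (λ r → fromℤ (coefficients r e)) + l · (fromℕ ∘ t)
          ≈⟨ ·-+ l _ _ ⟨
        l · (λ r → fromℤ (coefficients r e) + fromℕ (t r))
          ≤⟨ sum-mono-≤ (λ r → *-monoˡ-≤-nonNeg (fromℕ-nonNeg (l r))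
               (covers (constraintAt r) e (Vec.[]=⇒lookup e∈X))) ⟩
        sum (λ r → fromℕ (l r) * sel R (lookup (B r) e) (fromℕ (w r)))
          ≈⟨ sum-cong (λ r → sel-*ˡ (lookup (B r) e) _ _) ⟨
        sum (λ r → sel R (lookup (B r) e) (fromℕ (l r) * fromℕ (w r)))
          ∎
        where
        open ≤-Reasoning
        column≈0 : l · (λ r → fromℤ (coefficients r e)) ≈ 0#
        column≈0 = trans (·-column coefficients l e) (reflexive (≡.cong fromℤ (balanced e)))

      -- With T > 0 the capacity constraints, scaled by 1/T, cover X; fractional subadditivity gives T f(X) ≤ P.
      Tf≤P : fromℕ T * f X ≤ P
      Tf≤P = scaled T ≡.refl
        where
        scaled : ∀ t → T ≡ t → fromℕ t * f X ≤ P
        scaled zero    _   = ≤-respˡ (sym (zeroˡ (f X))) 0≤P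
        scaled (suc k) T≡τ = x≤y*z⁻¹⇒z*x≤y 0<τ (≤-respʳ fsa-sum≈P/τ (fsa X K B α 0≤α cover))
          where
          τ : Carrier
          τ = fromℕ (suc k)
          0<τ : 0# < τ
          0<τ = fromℕ-suc-pos k
          α : Fin K → Carrier
          α r = fromℕ (l r) * fromℕ (w r) * τ ⁻¹
          0≤α : ∀ r → 0# ≤ α r
          0≤α r = *-nonneg (*-nonneg (fromℕ-nonNeg (l r)) (fromℕ-nonNeg (w r))) (⁻¹-nonNeg 0<τ)
          paid : Fin K → Carrier
          paid r = fromℕ (l r) * (fromℕ (w r) * f (B r))
          covered : Fin n → Fin K → Carrier
          covered e r = sel R (lookup (B r) e) (fromℕ (l r) * fromℕ (w r))
          cover : ∀ e → e ∈ X → 1# ≤ sumFin R K (λ r → sel R (lookup (B r) e) (α r))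
          cover e e∈X = begin
            1#
              ≈⟨ ⁻¹-inverse τ (0<x⇒x≉0 0<τ) ⟨
            τ * τ ⁻¹
              ≤⟨ *-monoʳ-≤-nonNeg (⁻¹-nonNeg 0<τ) (≤-respˡ (reflexive (≡.cong fromℕ T≡τ)) (coverage e e∈X)) ⟩
            sum (covered e) * τ ⁻¹
              ≈⟨ *-distribʳ-sum (τ ⁻¹) (covered e) ⟩
            sum (λ r → covered e r * τ ⁻¹)
              ≈⟨ sum-cong (λ r → sel-*ʳ (lookup (B r) e) _ _) ⟨
            sum (λ r → sel R (lookup (B r) e) (α r))
              ≡⟨ sumFin≡sum K (λ r → sel R (lookup (B r) e) (α r)) ⟨
            sumFin R K (λ r → sel R (lookup (B r) e) (α r))
              ∎
            where
              open ≤-Reasoning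
          fsa-sum≈P/τ : sumFin R K (λ r → α r * f (B r)) ≈ P * τ ⁻¹
          fsa-sum≈P/τ = begin
            sumFin R K (λ r → α r * f (B r))
              ≡⟨ sumFin≡sum K (λ r → α r * f (B r)) ⟩
            sum (λ r → α r * f (B r))
              ≈⟨ sum-cong (λ r → solve 4 (λ a b c d → a :* b :* c :* d := a :* (b :* d) :* c)
                   refl (fromℕ (l r)) (fromℕ (w r)) (τ ⁻¹) (f (B r))) ⟩
            sum (λ r → paid r * τ ⁻¹)
              ≈⟨ *-distribʳ-sum (τ ⁻¹) paid ⟨
            P * τ ⁻¹
              ∎
            where
              open ≈-Reasoning

      0≤l·b : 0# ≤ l · (bound ∘ constraintAt)
      0≤l·b = ≤-respʳ (sym l·b≈P-Tf) (x≤y⇒0≤y-x Tf≤P)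

    supportingDual : (∀ S → 0# ≤ f S) → FracSubadditive R f →
      ∃ λ γ → DualFeasible R f γ × (f X ≤ sumOver R X γ)
    supportingDual 0≤f fsa = γ , feasible⇒dualFeasible γ feasible
      where
      solution : ∃ λ γ → ∀ r → row coefficients r γ ≤ bound (constraintAt r)
      solution = farkas coefficients (Certificate.0≤l·b 0≤f fsa)
      γ : Fin n → Carrier
      γ = proj₁ solution
      feasible : ∀ r → row coefficients r γ ≤ bound (constraintAt r)
      feasible = proj₂ solution

  f≤optimalDual : ∀ {n} {f : Subset n → Carrier} {X γ} → (∀ S → 0# ≤ f S) → FracSubadditive R f →
    OptimalDual R f X γ → f X ≤ sumOver R X γ
  f≤optimalDual {f = f} {X} 0≤f fsa (_ , optimal) = ≤-trans fX≤γ′X (optimal γ′ feasible′)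
    where
    open SupportingDual f X using (supportingDual)
    γ′ : Fin _ → Carrier
    γ′ = proj₁ (supportingDual 0≤f fsa)
    feasible′ : DualFeasible R f γ′
    feasible′ = proj₁ (proj₂ (supportingDual 0≤f fsa))
    fX≤γ′X : f X ≤ sumOver R X γ′
    fX≤γ′X = proj₂ (proj₂ (supportingDual 0≤f fsa))

  -- The knapsack bound

  greedy-≤ : ∀ {n} {S P : Subset n} {γ w : Fin n → Carrier} {d} →
    (∀ {i} → i ∈ P → i ∈ S × d * w i ≤ γ i) → (∀ {i} → i ∈ S → i ∉ P → γ i ≤ d * w i) →
    sumOver R S γ ≤ sumOver R P γ + d * (sumOver R S w - sumOver R P w)
  greedy-≤ {n} {S} {P} {γ} {w} {d} dense sparse
    rewrite sumOver≡sum S γ | sumOver≡sum P γ | sumOver≡sum S w | sumOver≡sum P w = begin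
    sum (restrict S γ)
      ≤⟨ sum-mono-≤ pointwise ⟩
    sum (λ i → restrict P γ i + d * Δw i)
      ≈⟨ ∑-distrib-+ (restrict P γ) (λ i → d * Δw i) ⟩
    sum (restrict P γ) + sum (λ i → d * Δw i)
      ≈⟨ +-congˡ (*-distribˡ-sum d Δw) ⟨
    sum (restrict P γ) + d * sum Δw
      ≈⟨ +-congˡ (*-congˡ (trans (∑-distrib-+ (restrict S w) (λ i → - restrict P w i))
                                 (+-congˡ (sum-neg (restrict P w))))) ⟩
    sum (restrict P γ) + d * (sum (restrict S w) - sum (restrict P w))
      ∎
    where
    open ≤-Reasoning
    Δw : Fin n → Carrier
    Δw i = restrict S w i - restrict P w i
    pointwise : ∀ i → restrict S γ i ≤ restrict P γ i + d * Δw i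
    pointwise i with lookup P i in P[i] | lookup S i in S[i]
    ... | inside  | inside  = ≤-reflexive (solve 3 (λ g d w → g := g :+ d :* (w :- w)) refl (γ i) d (w i))
    ... | inside  | outside = contradiction
      (≡.trans (≡.sym S[i]) (Vec.[]=⇒lookup (proj₁ (dense (Vec.lookup⇒[]= i P P[i]))))) λ ()
    ... | outside | inside  = ≤-respʳ (sym (trans (+-identityˡ _) (*-congˡ (trans (+-congˡ -0#≈0#) (+-identityʳ _)))))
      (sparse (Vec.lookup⇒[]= i S S[i]) λ i∈P → contradiction (≡.trans (≡.sym P[i]) (Vec.[]=⇒lookup i∈P)) λ ())
    ... | outside | outside = ≤-reflexive (sym (trans (+-identityˡ _)
      (trans (*-congˡ (trans (+-congˡ -0#≈0#) (+-identityʳ 0#))) (zeroʳ d))))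

  adjacent⇒antitone : ∀ {m} {g : Fin m → Carrier} → (∀ j k → toℕ k ≡ suc (toℕ j) → g k ≤ g j) →
    ∀ {j k} → toℕ j ℕ.≤ toℕ k → g k ≤ g j
  adjacent⇒antitone {m} {g} adjacent {j} {k} j≤k = go (toℕ k ℕ.∸ toℕ j) k (≡.sym (ℕ.m∸n+n≡m j≤k))
    where
    go : ∀ gap k → toℕ k ≡ gap ℕ.+ toℕ j → g k ≤ g j
    go zero    k k≡j = ≤-reflexive (reflexive (≡.cong g (Fin.toℕ-injective k≡j)))
    go (suc gap) k k≡ = ≤-trans (adjacent k′ k (≡.trans k≡ (≡.cong suc (≡.sym k′≡)))) (go gap k′ k′≡)
      where
      k′<m : gap ℕ.+ toℕ j ℕ.< m
      k′<m = ℕ.<-trans (ℕ.≤-reflexive (≡.sym k≡)) (Fin.toℕ<n k)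
      k′ : Fin m
      k′ = Fin.fromℕ< k′<m
      k′≡ : toℕ k′ ≡ gap ℕ.+ toℕ j
      k′≡ = Fin.toℕ-fromℕ< k′<m

  module KnapsackBound {n} (w : Fin n → Carrier) (M : Carrier) (f : Subset n → Carrier)
    (0<w : ∀ e → 0# < w e) (1≤M : 1# ≤ M) (0≤f : ∀ S → 0# ≤ f S) (mono : Monotone R f)
    (bounded : MBounded R M f) (fsa : FracSubadditive R f)
    (C C′ : Carrier) (0<C : 0# < C) (C≤C′ : C ≤ C′)
    (S′ : Subset n) (S′-optimal : IsOptimal R f w C′ S′)
    (γ : Fin n → Carrier) (γ-optimal : OptimalDual R f S′ γ)
    {m} (e : Fin m → Fin n)
    (enumerates : ∀ i → (i ∈ S′ → ∃ λ k → e k ≡ i) × ((∃ λ k → e k ≡ i) → i ∈ S′))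
    (sorted : ∀ (j k : Fin m) → toℕ k ≡ suc (toℕ j) → γ (e k) * w (e k) ⁻¹ ≤ γ (e j) * w (e j) ⁻¹)
    (j : ℕ) (maximal : ∀ j′ → j′ ℕ.≤ m → sumOver R (prefixSet e j′) w ≤ C → j′ ℕ.≤ j) where

    r : Carrier
    r = C′ * C ⁻¹

    1≤r : 1# ≤ r
    1≤r = y≤x⇒1≤x*y⁻¹ 0<C C≤C′

    P : Subset n
    P = prefixSet e j

    0≤γ : ∀ i → 0# ≤ γ i
    0≤γ = proj₁ (proj₁ γ-optimal)

    γ≤f : ∀ B → sumOver R B γ ≤ f B
    γ≤f = proj₂ (proj₁ γ-optimal)

    everything-fits : j ≡ m → f S′ ≤ r * (f P + M)
    everything-fits ≡.refl =
      ≤-trans (≤-trans (mono P S′ S′⊆P) fP≤fP+M) (x≤rx 1≤r (≤-trans (0≤f P) fP≤fP+M))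
      where
      S′⊆P : S′ ⊆ P
      S′⊆P i∈S′ with proj₁ (enumerates _) i∈S′
      ... | k , ≡.refl = ∈-prefixSet⁺ e j (Fin.toℕ<n k)
      fP≤fP+M : f P ≤ f P + M
      fP≤fP+M = ≤-respˡ (+-identityʳ (f P)) (+-monoʳ-≤ (f P) (1≤x⇒0≤x 1≤M))

    module Truncated (j<m : j ℕ.< m) where

      k₀ : Fin m
      k₀ = Fin.fromℕ< j<m

      e₀ : Fin n
      e₀ = e k₀

      P′ : Subset n
      P′ = prefixSet e (suc j)

      density : Fin n → Carrier
      density i = γ i * w i ⁻¹

      d : Carrier
      d = density e₀

      0≤d : 0# ≤ d
      0≤d = *-nonneg (0≤γ e₀) (⁻¹-nonNeg (0<w e₀))

      density-antitone : ∀ {k k′} → toℕ k ℕ.≤ toℕ k′ → density (e k′) ≤ density (e k)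
      density-antitone = adjacent⇒antitone sorted

      dense : ∀ {i} → i ∈ P′ → i ∈ S′ × d * w i ≤ γ i
      dense i∈P′ with ∈-prefixSet⁻ e (suc j) i∈P′
      ... | k , k<1+j , ≡.refl = proj₂ (enumerates (e k)) (k , ≡.refl) ,
        ≤-respˡ (*-comm _ _) (x≤y*z⁻¹⇒z*x≤y (0<w (e k))
          (density-antitone (ℕ.≤-trans (ℕ.m<1+n⇒m≤n k<1+j) (ℕ.≤-reflexive (≡.sym (Fin.toℕ-fromℕ< j<m))))))

      sparse : ∀ {i} → i ∈ S′ → i ∉ P′ → γ i ≤ d * w i
      sparse i∈S′ i∉P′ with proj₁ (enumerates _) i∈S′
      ... | k , ≡.refl with toℕ k ℕ.<? suc j
      ...   | yes k<1+j = contradiction (∈-prefixSet⁺ e (suc j) k<1+j) i∉P′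
      ...   | no k≮1+j = ≤-respʳ (*-comm _ _) (x*z⁻¹≤y⇒x≤z*y (0<w (e k))
          (density-antitone (ℕ.≤-trans (ℕ.≤-reflexive (Fin.toℕ-fromℕ< j<m)) (ℕ.<⇒≤ (ℕ.≮⇒≥ k≮1+j)))))

      P′⊆P∪e₀ : ∀ {i} → i ∈ P′ → i ∈ P ⊎ i ∈ ⁅ e₀ ⁆
      P′⊆P∪e₀ i∈P′ with ∈-prefixSet⁻ e (suc j) i∈P′
      ... | k , k<1+j , ≡.refl with ℕ.m≤n⇒m<n∨m≡n (ℕ.m<1+n⇒m≤n k<1+j)
      ...   | inj₁ k<j = inj₁ (∈-prefixSet⁺ e j k<j)
      ...   | inj₂ k≡j rewrite Fin.toℕ-injective (≡.trans k≡j (≡.sym (Fin.toℕ-fromℕ< j<m))) =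
                inj₂ (x∈⁅x⁆ e₀)

      C≤wP′ : C ≤ sumOver R P′ w
      C≤wP′ with total C (sumOver R P′ w)
      ... | inj₁ C≤wP′ = C≤wP′
      ... | inj₂ wP′≤C = contradiction (maximal (suc j) j<m wP′≤C) ℕ.1+n≰n

      dC≤γP′ : d * C ≤ sumOver R P′ γ
      dC≤γP′ = ≤-trans (*-monoˡ-≤-nonNeg 0≤d C≤wP′)
        (≤-respˡ (sumOver-*ˡ P′ d w) (sumOver-mono-≤ P′ (proj₂ ∘ dense)))

      γP′≤fP+M : sumOver R P′ γ ≤ f P + M
      γP′≤fP+M = ≤-trans (sumOver-≤-∪ 0≤γ P′⊆P∪e₀)
        (+-mono-≤ (γ≤f P) (≤-trans (γ≤f ⁅ e₀ ⁆) (proj₂ (bounded e₀))))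

      bound : f S′ ≤ r * (f P + M)
      bound = begin
        f S′
          ≤⟨ f≤optimalDual 0≤f fsa γ-optimal ⟩
        sumOver R S′ γ
          ≤⟨ greedy-≤ dense sparse ⟩
        sumOver R P′ γ + d * (sumOver R S′ w - sumOver R P′ w)
          ≤⟨ +-monoʳ-≤ _ (*-monoˡ-≤-nonNeg 0≤d (+-mono-≤ (proj₁ S′-optimal) (-‿antimono-≤ C≤wP′))) ⟩
        sumOver R P′ γ + d * (C′ - C)
          ≤⟨ extrapolate-≤ 0≤d 0<C C≤C′ dC≤γP′ ⟩
        r * sumOver R P′ γ
          ≤⟨ *-monoˡ-≤-nonNeg (1≤x⇒0≤x 1≤r) γP′≤fP+M ⟩
        r * (f P + M)
          ∎
        where
          open ≤-Reasoning

    bound : j ℕ.≤ m → f S′ ≤ r * (f P + M)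
    bound j≤m with ℕ.m≤n⇒m<n∨m≡n j≤m
    ... | inj₁ j<m = Truncated.bound j<m
    ... | inj₂ j≡m = everything-fits j≡m

lemma2 : ∀ {c ℓ₁ ℓ₂ : Level} (R : OrderedField c ℓ₁ ℓ₂) →
    let open OrderedField R in
    ∀ (n : ℕ) (w : Fin n → Carrier) (M : Carrier) (f : Subset n → Carrier) →
    (∀ e → 0# < w e) → 1# ≤ M →
    (∀ S → 0# ≤ f S) → Monotone R f → MBounded R M f → FracSubadditive R f →
    ∀ (C C' : Carrier) → 0# < C → C ≤ C' → C' ≤ sumOver R ⊤ w →
    -- S' = S*_{C'}, a fixed set attaining f*(C')
    ∀ (S' : Subset n) → IsOptimal R f w C' S' →
    -- γ = γ*(S*_{C'}), a fixed optimal dual solution of (LP_{S'})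
    ∀ (γ : Fin n → Carrier) → OptimalDual R f S' γ →
    -- an enumeration e_1,…,e_m of S' sorted by non-increasing γ/w
    ∀ (m : ℕ) (e : Fin m → Fin n) → Injective _≡_ _≡_ e →
    (∀ i → (i ∈ S' → ∃ λ k → e k ≡ i) × ((∃ λ k → e k ≡ i) → i ∈ S')) →
    (∀ (j k : Fin m) → toℕ k ≡ suc (toℕ j) →
       γ (e k) * w (e k) ⁻¹ ≤ γ (e j) * w (e j) ⁻¹) →
    -- j is the largest index in {0,…,m} with w({e_1,…,e_j}) ≤ C
    ∀ (j : ℕ) → j ℕ.≤ m → sumOver R (prefixSet e j) w ≤ C →
    (∀ (j' : ℕ) → j' ℕ.≤ m → sumOver R (prefixSet e j') w ≤ C → j' ℕ.≤ j) →
    -- f*(C') ≤ (C'/C) (f(S*_{C',C}) + M)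
    f S' ≤ (C' * C ⁻¹) * (f (prefixSet e j) + M)
lemma2 R n w M f 0<w 1≤M 0≤f mono bounded fsa C C′ 0<C C≤C′ _ S′ S′-optimal γ γ-optimal m e _
  enumerates sorted j j≤m _ maximal =
  KnapsackBound.bound R w M f 0<w 1≤M 0≤f mono bounded fsa C C′ 0<C C≤C′ S′ S′-optimal γ γ-optimal
    e enumerates sorted j maximal j≤m
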